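{- Let $(X,Y,\phi)$ be an $L$-context and $Y'\subseteq Y$. The following are equivalent: (i) $Y\setminus Y'$ is $\phi$-reducible in RST; (ii) $\phi^\forall\lambda=(\phi_{X,Y'})^\forall(\phi^\exists\phi^\forall\lambda)_{Y'}$ for all $\lambda\in L^Y$; (iii) $\phi^\forall\phi^\exists=(\phi_{X,Y'})^\forall(\phi_{X,Y'})^\exists$ as maps $L^X\to L^X$; (iv) $\mathcal K\phi=\mathcal K\phi_{X,Y'}$ and the map $\mathcal K(1_X,\nu)\colon\mathcal K\phi\to\mathcal K\phi_{X,Y'}$, $\mu\mapsto(\phi_{X,Y'})^\forall(\phi_{X,Y'})^\exists\mu$, is the identity function.
   Context: $L=(L,*)$ is a complete residuated lattice: a complete lattice with bottom $0$ and top $1$ with a commutative monoid operation $*$ with unit $1$ satisfying $a*\bigvee_i b_i=\bigvee_i a*b_i$; $\rightarrow$ is its residuum ($a*b\le c\iff a\le b\rightarrow c$). An $L$-context is $(X,Y,\phi)$ with $\phi\colon X\times Y\to L$. $L^X$ is the set of maps $X\to L$. Define $\phi^\exists\colon L^X\to L^Y$, $\phi^\exists(\mu)(y)=\bigvee_x\mu(x)*\phi(x,y)$, $\phi^\forall\colon L^Y\to L^X$, $\phi^\forall(\lambda)(x)=\bigwedge_y\phi(x,y)\rightarrow\lambda(y)$, and $\mathcal K\phi=\{\mu\in L^X:\phi^\forall\phi^\exists\mu=\mu\}$. $\phi_{X,Y'}$ is the restriction of $\phi$ to $X\times Y'$, $\nu\colon Y'\to Y$ the inclusion, and $\lambda_{Y'}$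 the restriction of $\lambda\in L^Y$ to $Y'$. $Y\setminus Y'$ is $\phi$-reducible in RST if for every $\lambda\in L^Y$ there is $\lambda'\in L^{Y'}$ with $\phi^\forall\lambda=(\phi_{X,Y'})^\forall\lambda'$. -}

module Defs where

open import Level using (Level; _⊔_; suc)
open import Data.Product using (Σ; ∃; _×_; _,_)
open import Relation.Binary.PropositionalEquality using (_≡_)
open import Relation.Binary.Structures using (IsPartialOrder)
open import Function.Bundles using (_⇔_)
open import Function.Definitions using (Injective)

-- Completeness is with respect to families
-- indexed by types in the universe Set ι (the universe of the contexts' X, Y).
record CompleteResiduatedLattice (c ℓ ι : Level) : Set (suc (c ⊔ ℓ ⊔ ι)) where
  infixr 6 _*_
  infixr 5 _⇒_
  infix 4 _≤_
  field
    Carrier        : Set c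
    _≤_            : Carrier → Carrier → Set ℓ
    isPartialOrder : IsPartialOrder _≡_ _≤_
    ⋁              : {I : Set ι} → (I → Carrier) → Carrier
    ⋁-upper        : {I : Set ι} (f : I → Carrier) (i : I) → f i ≤ ⋁ f
    ⋁-least        : {I : Set ι} (f : I → Carrier) (z : Carrier) → (∀ i → f i ≤ z) → ⋁ f ≤ z
    ⋀              : {I : Set ι} → (I → Carrier) → Carrier
    ⋀-lower        : {I : Set ι} (f : I → Carrier) (i : I) → ⋀ f ≤ f i
    ⋀-greatest     : {I : Set ι} (f : I → Carrier) (z : Carrier) → (∀ i → z ≤ f i) → z ≤ ⋀ f
    0#             : Carrier
    1#             : Carrier
    0-least        : ∀ a → 0# ≤ a
    1-greatest     : ∀ a → a ≤ 1#
    _*_            : Carrier → Carrier → Carrier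
    *-assoc        : ∀ a b d → (a * b) * d ≡ a * (b * d)
    *-comm         : ∀ a b → a * b ≡ b * a
    *-identityˡ    : ∀ a → 1# * a ≡ a
    *-distrib-⋁    : ∀ a {I : Set ι} (f : I → Carrier) → a * ⋁ f ≡ ⋁ (λ i → a * f i)
    _⇒_            : Carrier → Carrier → Carrier
    residuated     : ∀ a b d → (a * b ≤ d) ⇔ (a ≤ b ⇒ d)

module Context {c ℓ ι : Level} (𝕃 : CompleteResiduatedLattice c ℓ ι) where
  open CompleteResiduatedLattice 𝕃

  L^ : Set ι → Set (c ⊔ ι)
  L^ X = X → Carrier

  _≐_ : {X : Set ι} → L^ X → L^ X → Set (c ⊔ ι)
  μ ≐ μ' = ∀ x → μ x ≡ μ' x

  _^∃ : {X Y : Set ι} → (X → Y → Carrier) → L^ X → L^ Y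
  (φ ^∃) μ y = ⋁ (λ x → μ x * φ x y)

  _^∀ : {X Y : Set ι} → (X → Y → Carrier) → L^ Y → L^ X
  (φ ^∀) λ' x = ⋀ (λ y → φ x y ⇒ λ' y)

  _∈𝒦_ : {X Y : Set ι} → L^ X → (X → Y → Carrier) → Set (c ⊔ ι)
  μ ∈𝒦 φ = (φ ^∀) ((φ ^∃) μ) ≐ μ

  -- restriction φ_{X,Y'} along the inclusion ν : Y' → Y
  restrict : {X Y Y' : Set ι} → (X → Y → Carrier) → (Y' → Y) → (X → Y' → Carrier)
  restrict φ ν x y' = φ x (ν y')

  ReducibleRST : {X Y Y' : Set ι} → (X → Y → Carrier) → (Y' → Y) → Set (c ⊔ ι)
  ReducibleRST {Y = Y} {Y' = Y'} φ ν =
    (λ' : L^ Y) → Σ (L^ Y') (λ λ'' → (φ ^∀) λ' ≐ (restrict φ ν ^∀) λ'')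

  Cond2 : {X Y Y' : Set ι} → (X → Y → Carrier) → (Y' → Y) → Set (c ⊔ ι)
  Cond2 {Y = Y} φ ν =
    (λ' : L^ Y) → (φ ^∀) λ' ≐ (restrict φ ν ^∀) (λ y' → (φ ^∃) ((φ ^∀) λ') (ν y'))

  Cond3 : {X Y Y' : Set ι} → (X → Y → Carrier) → (Y' → Y) → Set (c ⊔ ι)
  Cond3 {X = X} φ ν =
    (μ : L^ X) → (φ ^∀) ((φ ^∃) μ) ≐ (restrict φ ν ^∀) ((restrict φ ν ^∃) μ)

  Cond4 : {X Y Y' : Set ι} → (X → Y → Carrier) → (Y' → Y) → Set (c ⊔ ι)
  Cond4 {X = X} φ ν =
    ((μ : L^ X) → (μ ∈𝒦 φ) ⇔ (μ ∈𝒦 restrict φ ν))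
    × ((μ : L^ X) → μ ∈𝒦 φ → (restrict φ ν ^∀) ((restrict φ ν ^∃) μ) ≐ μ)

{-# OPTIONS --safe #-}
-- Since φ^∃ ⊣ φ^∀, the map φ^∀φ^∃ is a closure operator on L^X whose closed sets
-- are exactly the images of φ^∀.  With ψ = φ_{X,Y'}, restricting the attributes
-- can only enlarge closures (φ^∀φ^∃ ≤ ψ^∀ψ^∃), so the two closure operators agree
-- iff every φ-closed set is ψ-closed, i.e. iff every φ^∀λ is of the form ψ^∀λ'.
-- When that holds, λ' may be taken to be ψ^∃φ^∀λ = (φ^∃φ^∀λ)_{Y'}, giving (ii).
module Submission where

open import Defs
open import Level using (Level; _⊔_)
open import Data.Product using (_×_; _,_)
open import Function.Base using (_∘_)
open import Function.Bundles using (_⇔_; mk⇔; Equivalence)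
open import Function.Definitions using (Injective)
open import Relation.Binary.Bundles using (Poset)
open import Relation.Binary.PropositionalEquality using (_≡_; sym; trans)

module Proof {c ℓ ι : Level} (𝕃 : CompleteResiduatedLattice c ℓ ι) where
  open CompleteResiduatedLattice 𝕃
  open Context 𝕃

  poset : Poset c c ℓ
  poset = record { isPartialOrder = isPartialOrder }

  open Poset poset using (antisym; reflexive) renaming (refl to ≤-refl; trans to ≤-trans)

  residual-intro : ∀ {a b d} → a * b ≤ d → a ≤ b ⇒ d
  residual-intro {a} {b} {d} = Equivalence.to (residuated a b d)

  residual-elim : ∀ {a b d} → a ≤ b ⇒ d → a * b ≤ d
  residual-elim {a} {b} {d} = Equivalence.from (residuated a b d)

  *-monoˡ-≤ : ∀ {a b d} → a ≤ b → a * d ≤ b * d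
  *-monoˡ-≤ a≤b = residual-elim (≤-trans a≤b (residual-intro ≤-refl))

  ⇒-monoʳ-≤ : ∀ {a b d} → b ≤ d → a ⇒ b ≤ a ⇒ d
  ⇒-monoʳ-≤ b≤d = residual-intro (≤-trans (residual-elim ≤-refl) b≤d)

  infix 4 _⊑_

  _⊑_ : {X : Set ι} → L^ X → L^ X → Set (ℓ ⊔ ι)
  μ ⊑ μ' = ∀ x → μ x ≤ μ' x

  ⊑-antisym : {X : Set ι} {μ μ' : L^ X} → μ ⊑ μ' → μ' ⊑ μ → μ ≐ μ'
  ⊑-antisym μ⊑μ' μ'⊑μ x = antisym (μ⊑μ' x) (μ'⊑μ x)

  ≐⇒⊑ : {X : Set ι} {μ μ' : L^ X} → μ ≐ μ' → μ ⊑ μ'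
  ≐⇒⊑ μ≐μ' x = reflexive (μ≐μ' x)

  closure : {X Y : Set ι} → (X → Y → Carrier) → L^ X → L^ X
  closure φ = (φ ^∀) ∘ (φ ^∃)

  module _ {X Y : Set ι} (φ : X → Y → Carrier) where

    ^∃-mono : {μ μ' : L^ X} → μ ⊑ μ' → (φ ^∃) μ ⊑ (φ ^∃) μ'
    ^∃-mono μ⊑μ' y = ⋁-least _ _ λ x →
      ≤-trans (*-monoˡ-≤ (μ⊑μ' x)) (⋁-upper (λ x' → _ * φ x' y) x)

    ^∀-mono : {λ₁ λ₂ : L^ Y} → λ₁ ⊑ λ₂ → (φ ^∀) λ₁ ⊑ (φ ^∀) λ₂
    ^∀-mono λ₁⊑λ₂ x = ⋀-greatest _ _ λ y → ≤-trans (⋀-lower _ y) (⇒-monoʳ-≤ (λ₁⊑λ₂ y))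

    closure-inflationary : (μ : L^ X) → μ ⊑ closure φ μ
    closure-inflationary μ x = ⋀-greatest _ _ λ y →
      residual-intro (⋁-upper (λ x' → μ x' * φ x' y) x)

    ^∃^∀-deflationary : (λ' : L^ Y) → (φ ^∃) ((φ ^∀) λ') ⊑ λ'
    ^∃^∀-deflationary λ' y = ⋁-least _ _ λ x →
      residual-elim (⋀-lower (λ y' → φ x y' ⇒ λ' y') y)

    closure-mono : {μ μ' : L^ X} → μ ⊑ μ' → closure φ μ ⊑ closure φ μ'
    closure-mono = ^∀-mono ∘ ^∃-mono

    ^∀-∈𝒦 : (λ' : L^ Y) → (φ ^∀) λ' ∈𝒦 φ
    ^∀-∈𝒦 λ' = ⊑-antisym (^∀-mono (^∃^∀-deflationary λ')) (closure-inflationary ((φ ^∀) λ'))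

    closure-∈𝒦 : (μ : L^ X) → closure φ μ ∈𝒦 φ
    closure-∈𝒦 = ^∀-∈𝒦 ∘ (φ ^∃)

    closure-least : {μ κ : L^ X} → μ ⊑ κ → κ ∈𝒦 φ → closure φ μ ⊑ κ
    closure-least μ⊑κ κ∈𝒦 x = ≤-trans (closure-mono μ⊑κ x) (reflexive (κ∈𝒦 x))

    ∈𝒦-resp-≐ : {μ μ' : L^ X} → μ ≐ μ' → μ ∈𝒦 φ → μ' ∈𝒦 φ
    ∈𝒦-resp-≐ μ≐μ' μ∈𝒦 = ⊑-antisym
      (λ x → ≤-trans (closure-least (≐⇒⊑ (sym ∘ μ≐μ')) μ∈𝒦 x) (reflexive (μ≐μ' x)))
      (closure-inflationary _)

  𝒦_⊆𝒦_ : {X Y Y' : Set ι} → (X → Y → Carrier) → (X → Y' → Carrier) → Set (c ⊔ ι)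
  𝒦_⊆𝒦_ {X = X} φ ψ = (μ : L^ X) → μ ∈𝒦 φ → μ ∈𝒦 ψ

  module _ {X Y Y' : Set ι} (φ : X → Y → Carrier) (ν : Y' → Y) where

    ^∀-restrict : (λ' : L^ Y) → (φ ^∀) λ' ⊑ (restrict φ ν ^∀) (λ' ∘ ν)
    ^∀-restrict λ' x = ⋀-greatest _ _ λ y' → ⋀-lower _ (ν y')

    -- (restrict φ ν ^∃) μ is definitionally ((φ ^∃) μ) ∘ ν.
    closure-restrict : (μ : L^ X) → closure φ μ ⊑ closure (restrict φ ν) μ
    closure-restrict μ = ^∀-restrict ((φ ^∃) μ)

    𝒦-restrict⊆𝒦 : 𝒦 restrict φ ν ⊆𝒦 φ
    𝒦-restrict⊆𝒦 μ μ∈𝒦 = ⊑-antisym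
      (λ x → ≤-trans (closure-restrict μ x) (reflexive (μ∈𝒦 x)))
      (closure-inflationary φ μ)

    private
      ψ : X → Y' → Carrier
      ψ = restrict φ ν

    reducible⇒𝒦⊆𝒦 : ReducibleRST φ ν → 𝒦 φ ⊆𝒦 ψ
    reducible⇒𝒦⊆𝒦 reducible μ μ∈𝒦 with reducible ((φ ^∃) μ)
    ... | λ' , φ^∀≐ψ^∀ = ∈𝒦-resp-≐ ψ (λ x → trans (sym (φ^∀≐ψ^∀ x)) (μ∈𝒦 x)) (^∀-∈𝒦 ψ λ')

    𝒦⊆𝒦⇒cond3 : 𝒦 φ ⊆𝒦 ψ → Cond3 φ ν
    𝒦⊆𝒦⇒cond3 𝒦⊆𝒦 μ = ⊑-antisym
      (closure-restrict μ)
      (closure-least ψ (closure-inflationary φ μ) (𝒦⊆𝒦 (closure φ μ) (closure-∈𝒦 φ μ)))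

    cond3⇒cond2 : Cond3 φ ν → Cond2 φ ν
    cond3⇒cond2 cond3 λ' x = trans (sym (^∀-∈𝒦 φ λ' x)) (cond3 ((φ ^∀) λ') x)

    cond2⇒reducible : Cond2 φ ν → ReducibleRST φ ν
    cond2⇒reducible cond2 λ' = ((φ ^∃) ((φ ^∀) λ') ∘ ν) , cond2 λ'

    cond3⇒cond4 : Cond3 φ ν → Cond4 φ ν
    cond3⇒cond4 cond3 =
      (λ μ → mk⇔ (λ μ∈𝒦 x → trans (sym (cond3 μ x)) (μ∈𝒦 x)) (𝒦-restrict⊆𝒦 μ)) ,
      (λ μ μ∈𝒦 x → trans (sym (cond3 μ x)) (μ∈𝒦 x))

    cond4⇒𝒦⊆𝒦 : Cond4 φ ν → 𝒦 φ ⊆𝒦 ψ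
    cond4⇒𝒦⊆𝒦 (𝒦≡𝒦 , _) μ = Equivalence.to (𝒦≡𝒦 μ)

    reducible⇒cond3 : ReducibleRST φ ν → Cond3 φ ν
    reducible⇒cond3 = 𝒦⊆𝒦⇒cond3 ∘ reducible⇒𝒦⊆𝒦

    cond3⇒reducible : Cond3 φ ν → ReducibleRST φ ν
    cond3⇒reducible = cond2⇒reducible ∘ cond3⇒cond2

proposition4p8 : {c ℓ ι : Level} (𝕃 : CompleteResiduatedLattice c ℓ ι)
    → (X Y Y' : Set ι) (φ : X → Y → CompleteResiduatedLattice.Carrier 𝕃)
    (ν : Y' → Y) → Injective _≡_ _≡_ ν
    → (Context.ReducibleRST 𝕃 φ ν ⇔ Context.Cond2 𝕃 φ ν)
    × (Context.ReducibleRST 𝕃 φ ν ⇔ Context.Cond3 𝕃 φ ν)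
    × (Context.ReducibleRST 𝕃 φ ν ⇔ Context.Cond4 𝕃 φ ν)
proposition4p8 𝕃 X Y Y' φ ν _ =
  mk⇔ (cond3⇒cond2 φ ν ∘ reducible⇒cond3 φ ν) (cond2⇒reducible φ ν) ,
  mk⇔ (reducible⇒cond3 φ ν) (cond3⇒reducible φ ν) ,
  mk⇔ (cond3⇒cond4 φ ν ∘ reducible⇒cond3 φ ν)
      (cond3⇒reducible φ ν ∘ 𝒦⊆𝒦⇒cond3 φ ν ∘ cond4⇒𝒦⊆𝒦 φ ν)
  where open Proof 𝕃
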